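{- Let $x,y,z\in\mathbb{C}$ with $y+xz\neq0$, and let $\alpha=(\alpha_i)_{i\geq0}$, $\beta=(\beta_j)_{j\geq0}$ be complex sequences with $\alpha_0=\beta_0$. Define $\widetilde{\alpha}$ and $\widetilde{\beta}$ by $\widetilde{\alpha}_0=\alpha_0$, $\widetilde{\alpha}_i=\alpha_i-\sum_{k=0}^{i-1}\binom{i}{k}z^{i-k}\widetilde{\alpha}_k$ for $i\geq1$, and $\widetilde{\beta}_0=\beta_0$, $\widetilde{\beta}_i=\bigl(\beta_i-\sum_{k=0}^{i-1}\binom{i}{k}x^{i-k}(y+xz)^k\widetilde{\beta}_k\bigr)/(y+xz)^i$ for $i\geq1$. Then the Toeplitz matrix $P_{\widetilde{\alpha},\widetilde{\beta}}^{[0,1,0]}$ is a diagonal matrix if and only if there is a constant $c\in\mathbb{C}$ such that $\alpha_i=cz^i$ and $\beta_j=cx^j$ for all $i,j\geq0$.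
   Context: For complex numbers $x,y,z$ and complex sequences $\alpha,\beta$ with $\alpha_0=\beta_0$, the weighted recurrence matrix $P_{\alpha,\beta}^{[x,y,z]}=[P_{i,j}]_{i,j\geq0}$ is the infinite matrix with $P_{i,0}=\alpha_i$, $P_{0,j}=\beta_j$, and $P_{i,j}=xP_{i,j-1}+yP_{i-1,j-1}+zP_{i-1,j}$ for $i,j\geq1$. Thus $P_{\widetilde{\alpha},\widetilde{\beta}}^{[0,1,0]}$ is the infinite Toeplitz matrix with entries $\widetilde{\alpha}_{i-j}$ for $i\geq j$ and $\widetilde{\beta}_{j-i}$ for $j\geq i$. (This Toeplitz matrix is the middle factor in the factorization $P_{\alpha,\beta}^{[x,y,z]}=P_{\lambda_z,\mu}^{[0,1,z]}P_{\widetilde{\alpha},\widetilde{\beta}}^{[0,1,0]}(P_{\lambda_x,\mu}^{[0,y+xz,x]})^t$, where $\lambda_z=(z^i)_{i\geq0}$ and $\mu=(1,0,0,\ldots)$.) The convention $0^0=1$ is used. -}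

module Defs where

open import Level using (Level; _⊔_) renaming (suc to lsuc)
open import Data.Nat using (ℕ; zero; suc; _∸_; _<?_)
open import Data.Nat.Combinatorics using (_C_)
open import Data.Product using (∃; proj₁)
open import Relation.Nullary using (¬_; yes; no)
open import Algebra.Bundles using (CommutativeRing)
open import Relation.Binary.PropositionalEquality using (_≢_)

record Field (c ℓ : Level) : Set (lsuc (c ⊔ ℓ)) where
  field
    commutativeRing : CommutativeRing c ℓ
  open CommutativeRing commutativeRing public
  field
    1≉0     : ¬ (1# ≈ 0#)
    inverse : ∀ a → ¬ (a ≈ 0#) → ∃ λ b → a * b ≈ 1#

module FieldDefs {c ℓ : Level} (F : Field c ℓ) where
  open Field F hiding (zero)

  -- powers, with the convention a ^ 0 = 1 (so 0 ^ 0 = 1)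
  infixr 8 _^_
  _^_ : Carrier → ℕ → Carrier
  a ^ zero  = 1#
  a ^ suc n = a * (a ^ n)

  fromℕ : ℕ → Carrier
  fromℕ zero    = 0#
  fromℕ (suc n) = 1# + fromℕ n

  sumTo : ℕ → (ℕ → Carrier) → Carrier
  sumTo zero    f = 0#
  sumTo (suc n) f = sumTo n f + f n

  -- course-of-values recursion: step n f computes the n-th term
  -- from the previous terms f 0, ..., f (n-1)
  covAux : (ℕ → (ℕ → Carrier) → Carrier) → ℕ → ℕ → Carrier
  covAux step zero    k = 0#
  covAux step (suc n) k with k <? n
  ... | yes _ = covAux step n k
  ... | no  _ = step n (covAux step n)

  cov : (ℕ → (ℕ → Carrier) → Carrier) → ℕ → Carrier
  cov step i = covAux step (suc i) i

  alphaTilde : Carrier → (ℕ → Carrier) → ℕ → Carrier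
  alphaTilde z α = cov step
    where
    step : ℕ → (ℕ → Carrier) → Carrier
    step zero    f = α zero
    step (suc i) f = α (suc i) + - sumTo (suc i)
                       (λ k → fromℕ (suc i C k) * (z ^ (suc i ∸ k)) * f k)

  -- β̃ : β̃₀ = β₀,
  -- β̃ᵢ = (βᵢ - Σ_{k<i} C(i,k) x^{i-k} (y+xz)^k β̃ₖ) / (y+xz)^i,
  -- where division by (y+xz)^i is multiplication by w^i, w the inverse of y+xz
  betaTilde : (x y z : Carrier) → ¬ (y + x * z ≈ 0#) → (ℕ → Carrier) → ℕ → Carrier
  betaTilde x y z h β = cov step
    where
    d : Carrier
    d = y + x * z
    w : Carrier
    w = proj₁ (inverse d h)
    step : ℕ → (ℕ → Carrier) → Carrier
    step zero    f = β zero
    step (suc i) f = (β (suc i) + - sumTo (suc i)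
                       (λ k → fromℕ (suc i C k) * (x ^ (suc i ∸ k)) * (d ^ k) * f k))
                     * (w ^ suc i)

  P : (ℕ → Carrier) → (ℕ → Carrier) → (x y z : Carrier) → ℕ → ℕ → Carrier
  P α β x y z i       zero    = α i
  P α β x y z zero    (suc j) = β (suc j)
  P α β x y z (suc i) (suc j) =
    x * P α β x y z (suc i) j + y * P α β x y z i j + z * P α β x y z i (suc j)

  IsDiagonal : (ℕ → ℕ → Carrier) → Set ℓ
  IsDiagonal M = ∀ i j → i ≢ j → M i j ≈ 0#

{-# OPTIONS --safe #-}
-- With weights [0,1,0] the matrix is constant along its diagonals, so it is diagonal
-- iff α̃ᵢ = 0 and β̃ᵢ = 0 for all i ≥ 1.  If α̃ₖ = 0 for 0 < k < i, the sum defining α̃ᵢ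
-- collapses to its k = 0 term, so α̃ᵢ = αᵢ - α₀ zⁱ; likewise β̃ᵢ = (βᵢ - β₀ xⁱ)/(y+xz)ⁱ.
-- By strong induction the tails of α̃ and β̃ vanish iff α and β are geometric with
-- ratios z and x, and α₀ = β₀ makes the two leading constants one constant c.
module Submission where

open import Defs
open import Level using (Level)
open import Data.Nat using (ℕ; zero; suc; _<_; _<?_; _∸_; s≤s)
open import Data.Nat.Properties using (<-irrefl; m≤n⇒m<n∨m≡n; m<n⇒m<1+n; ≤-refl)
open import Data.Nat.Induction using (<-rec)
open import Data.Nat.Combinatorics using (_C_)
open import Data.Product using (∃; _×_; _,_; proj₁; proj₂)
open import Data.Product.Function.NonDependent.Propositional using (_×-⇔_)
open import Data.Sum using (inj₁; inj₂)
open import Data.Empty using (⊥-elim)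
open import Relation.Nullary using (¬_; yes; no)
open import Relation.Binary.PropositionalEquality as ≡ using (_≡_)
open import Function.Bundles using (_⇔_; mk⇔; module Equivalence)
open import Function.Construct.Composition using (_⇔-∘_)
import Algebra.Properties.Group as GroupProperties
import Algebra.Properties.CommutativeSemigroup as CommutativeSemigroupProperties
import Relation.Binary.Reasoning.Setoid as SetoidReasoning

module _ {c ℓ : Level} (F : Field c ℓ) where
  open Field F hiding (zero)
  open FieldDefs F
  open GroupProperties +-group using (x∙y⁻¹≈ε⇒x≈y; x≈y⇒x∙y⁻¹≈ε)
  open CommutativeSemigroupProperties *-commutativeSemigroup using (interchange)
  open SetoidReasoning setoid

  covAux≡cov : ∀ {step n k} → k < n → covAux step n k ≡ cov step k
  covAux≡cov {n = suc n} {k} (s≤s k≤n) with k <? n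
  ... | yes k<n = covAux≡cov k<n
  ... | no k≮n with m≤n⇒m<n∨m≡n k≤n
  ...   | inj₁ k<n = ⊥-elim (k≮n k<n)
  ...   | inj₂ ≡.refl with k <? k
  ...     | yes k<k = ⊥-elim (<-irrefl ≡.refl k<k)
  ...     | no _ = ≡.refl

  cov-unfold : ∀ {step} n → cov step n ≡ step n (covAux step n)
  cov-unfold n with n <? n
  ... | yes n<n = ⊥-elim (<-irrefl ≡.refl n<n)
  ... | no _ = ≡.refl

  sumTo-cong : ∀ n {f g} → (∀ {k} → k < n → f k ≈ g k) → sumTo n f ≈ sumTo n g
  sumTo-cong zero    f≈g = refl
  sumTo-cong (suc n) f≈g = +-cong (sumTo-cong n (λ k<n → f≈g (m<n⇒m<1+n k<n))) (f≈g ≤-refl)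

  sumTo-collapse : ∀ m {g} → (∀ {k} → k < m → g (suc k) ≈ 0#) → sumTo (suc m) g ≈ g 0
  sumTo-collapse zero    g≈0 = +-identityˡ _
  sumTo-collapse (suc m) g≈0 = begin
    sumTo (suc m) _ + _ ≈⟨ +-cong (sumTo-collapse m (λ k<m → g≈0 (m<n⇒m<1+n k<m))) (g≈0 ≤-refl) ⟩
    _ + 0#              ≈⟨ +-identityʳ _ ⟩
    _                   ∎

  ^-inverse : ∀ {a b} → a * b ≈ 1# → ∀ n → a ^ n * b ^ n ≈ 1#
  ^-inverse ab≈1 zero    = *-identityʳ 1#
  ^-inverse ab≈1 (suc n) = begin
    (_ * _) * (_ * _) ≈⟨ interchange _ _ _ _ ⟩
    _ * _             ≈⟨ *-cong ab≈1 (^-inverse ab≈1 n) ⟩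
    1# * 1#           ≈⟨ *-identityʳ 1# ⟩
    1#                ∎

  a-b≈0⇔a≈b : ∀ {a b} → (a + - b ≈ 0#) ⇔ (a ≈ b)
  a-b≈0⇔a≈b = mk⇔ (x∙y⁻¹≈ε⇒x≈y _ _) x≈y⇒x∙y⁻¹≈ε

  *-unit-≈0⇔ : ∀ {u v v′} → v * v′ ≈ 1# → (u * v ≈ 0#) ⇔ (u ≈ 0#)
  *-unit-≈0⇔ {u} {v} {v′} vv′≈1 = mk⇔ to (λ u≈0 → trans (*-congʳ u≈0) (zeroˡ v))
    where
    to : u * v ≈ 0# → u ≈ 0#
    to uv≈0 = begin
      u             ≈⟨ *-identityʳ u ⟨
      u * 1#        ≈⟨ *-congˡ vv′≈1 ⟨
      u * (v * v′)  ≈⟨ *-assoc u v v′ ⟨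
      (u * v) * v′  ≈⟨ *-congʳ uv≈0 ⟩
      0# * v′       ≈⟨ zeroˡ v′ ⟩
      0#            ∎

  ≈-≈0⇔ : ∀ {a b} → a ≈ b → (a ≈ 0#) ⇔ (b ≈ 0#)
  ≈-≈0⇔ a≈b = mk⇔ (trans (sym a≈b)) (trans a≈b)

  TailVanishes : (ℕ → Carrier) → Set ℓ
  TailVanishes t = ∀ i → t (suc i) ≈ 0#

  IsGeometric : (ℕ → Carrier) → Carrier → Set ℓ
  IsGeometric a r = ∀ i → a i ≈ a 0 * r ^ i

  tailVanishes⇔isGeometric : ∀ {t a r} →
    (∀ i → (∀ {k} → k < i → t (suc k) ≈ 0#) → (t (suc i) ≈ 0#) ⇔ (a (suc i) ≈ a 0 * r ^ suc i)) →
    TailVanishes t ⇔ IsGeometric a r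
  tailVanishes⇔isGeometric {t} {a} {r} step = mk⇔ to from
    where
    to : TailVanishes t → IsGeometric a r
    to t≈0 zero    = sym (*-identityʳ _)
    to t≈0 (suc i) = Equivalence.to (step i (λ {k} _ → t≈0 k)) (t≈0 i)
    from : IsGeometric a r → TailVanishes t
    from geo = <-rec _ (λ i below → Equivalence.from (step i below) (geo (suc i)))

  isGeometric×isGeometric⇔∃ : ∀ {α β x z} → α 0 ≈ β 0 →
    (IsGeometric α z × IsGeometric β x)
      ⇔ (∃ λ c → (∀ i → α i ≈ c * z ^ i) × (∀ j → β j ≈ c * x ^ j))
  isGeometric×isGeometric⇔∃ {α} α₀≈β₀ = mk⇔
    (λ (geoα , geoβ) → α 0 , geoα , λ j → trans (geoβ j) (*-congʳ (sym α₀≈β₀)))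
    (λ (c , α≈ , β≈) →
       (λ i → trans (α≈ i) (*-congʳ (sym (trans (α≈ 0) (*-identityʳ c))))) ,
       (λ j → trans (β≈ j) (*-congʳ (sym (trans (β≈ 0) (*-identityʳ c))))))

  toeplitz-shift : ∀ a b i j → P a b 0# 1# 0# (suc i) (suc j) ≈ P a b 0# 1# 0# i j
  toeplitz-shift a b i j = begin
    0# * _ + 1# * M i j + 0# * _ ≈⟨ +-cong (+-cong (zeroˡ _) (*-identityˡ _)) (zeroˡ _) ⟩
    0# + M i j + 0#              ≈⟨ +-identityʳ _ ⟩
    0# + M i j                   ≈⟨ +-identityˡ _ ⟩
    M i j                        ∎
    where
    M : ℕ → ℕ → Carrier
    M = P a b 0# 1# 0#

  toeplitz-isDiagonal⇔ : ∀ a b → IsDiagonal (P a b 0# 1# 0#) ⇔ (TailVanishes a × TailVanishes b)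
  toeplitz-isDiagonal⇔ a b = mk⇔
    (λ diag → (λ i → diag (suc i) 0 λ ()) , (λ j → diag 0 (suc j) λ ()))
    (λ (a≈0 , b≈0) → offDiagonal a≈0 b≈0)
    where
    offDiagonal : TailVanishes a → TailVanishes b → IsDiagonal (P a b 0# 1# 0#)
    offDiagonal a≈0 b≈0 zero    zero    i≢j = ⊥-elim (i≢j ≡.refl)
    offDiagonal a≈0 b≈0 zero    (suc j) i≢j = b≈0 j
    offDiagonal a≈0 b≈0 (suc i) zero    i≢j = a≈0 i
    offDiagonal a≈0 b≈0 (suc i) (suc j) i≢j =
      trans (toeplitz-shift a b i j) (offDiagonal a≈0 b≈0 i j (λ i≡j → i≢j (≡.cong suc i≡j)))

  binomial-leading : ∀ i r a → fromℕ (suc i C 0) * r ^ suc i * a ≈ a * r ^ suc i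
  binomial-leading i r a = begin
    (1# + 0#) * r ^ suc i * a ≈⟨ *-congʳ (*-congʳ (+-identityʳ 1#)) ⟩
    1# * r ^ suc i * a        ≈⟨ *-congʳ (*-identityˡ _) ⟩
    r ^ suc i * a             ≈⟨ *-comm _ a ⟩
    a * r ^ suc i             ∎

  module _ (z : Carrier) (α : ℕ → Carrier) where
    private
      α̃ : ℕ → Carrier
      α̃ = alphaTilde z α

    alphaTilde-collapse : ∀ i → (∀ {k} → k < i → α̃ (suc k) ≈ 0#) →
                          α̃ (suc i) ≈ α (suc i) + - (α 0 * z ^ suc i)
    alphaTilde-collapse i below = begin
      α̃ (suc i)                    ≡⟨ cov-unfold (suc i) ⟩
      α (suc i) + - sumTo (suc i) _ ≈⟨ +-congˡ (-‿cong (sumTo-cong (suc i)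
                                         (λ k<n → *-congˡ (reflexive (covAux≡cov k<n))))) ⟩
      α (suc i) + - sumTo (suc i) g ≈⟨ +-congˡ (-‿cong (sumTo-collapse i
                                         (λ k<i → trans (*-congˡ (below k<i)) (zeroʳ _)))) ⟩
      α (suc i) + - g 0             ≈⟨ +-congˡ (-‿cong (binomial-leading i z (α 0))) ⟩
      α (suc i) + - (α 0 * z ^ suc i) ∎
      where
      g : ℕ → Carrier
      g k = fromℕ (suc i C k) * z ^ (suc i ∸ k) * α̃ k

    alphaTilde-tailVanishes⇔ : TailVanishes α̃ ⇔ IsGeometric α z
    alphaTilde-tailVanishes⇔ = tailVanishes⇔isGeometric {t = α̃} {α} {z}
      (λ i below → a-b≈0⇔a≈b ⇔-∘ ≈-≈0⇔ (alphaTilde-collapse i below))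

  module _ (x y z : Carrier) (h : ¬ (y + x * z ≈ 0#)) (β : ℕ → Carrier) where
    private
      β̃ : ℕ → Carrier
      β̃ = betaTilde x y z h β
      d w : Carrier
      d = y + x * z
      w = proj₁ (inverse d h)

    betaTilde-collapse : ∀ i → (∀ {k} → k < i → β̃ (suc k) ≈ 0#) →
                         β̃ (suc i) ≈ (β (suc i) + - (β 0 * x ^ suc i)) * w ^ suc i
    betaTilde-collapse i below = begin
      β̃ (suc i)                                  ≡⟨ cov-unfold (suc i) ⟩
      (β (suc i) + - sumTo (suc i) _) * w ^ suc i ≈⟨ *-congʳ (+-congˡ (-‿cong (sumTo-cong (suc i)
                                                       (λ k<n → *-congˡ (reflexive (covAux≡cov k<n)))))) ⟩
      (β (suc i) + - sumTo (suc i) g) * w ^ suc i ≈⟨ *-congʳ (+-congˡ (-‿cong (sumTo-collapse i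
                                                       (λ k<i → trans (*-congˡ (below k<i)) (zeroʳ _))))) ⟩
      (β (suc i) + - g 0) * w ^ suc i             ≈⟨ *-congʳ (+-congˡ (-‿cong (trans
                                                       (*-congʳ (*-identityʳ _)) (binomial-leading i x (β 0))))) ⟩
      (β (suc i) + - (β 0 * x ^ suc i)) * w ^ suc i ∎
      where
      g : ℕ → Carrier
      g k = fromℕ (suc i C k) * x ^ (suc i ∸ k) * d ^ k * β̃ k

    betaTilde-tailVanishes⇔ : TailVanishes β̃ ⇔ IsGeometric β x
    betaTilde-tailVanishes⇔ = tailVanishes⇔isGeometric {t = β̃} {β} {x}
      (λ i below → a-b≈0⇔a≈b ⇔-∘ (*-unit-≈0⇔ (^-inverse wd≈1 (suc i)) ⇔-∘ ≈-≈0⇔ (betaTilde-collapse i below)))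
      where
      wd≈1 : w * d ≈ 1#
      wd≈1 = trans (*-comm w d) (proj₂ (inverse d h))

proposition3 : ∀ {c ℓ : Level} (F : Field c ℓ) →
    let open Field F in
    let open FieldDefs F in
    (x y z : Carrier) (h : ¬ (y + x * z ≈ 0#)) (α β : ℕ → Carrier) →
    α 0 ≈ β 0 →
    IsDiagonal (P (alphaTilde z α) (betaTilde x y z h β) 0# 1# 0#)
      ⇔ (∃ λ (c : Carrier) → (∀ i → α i ≈ c * (z ^ i)) × (∀ j → β j ≈ c * (x ^ j)))
proposition3 F x y z h α β α₀≈β₀ =
  isGeometric×isGeometric⇔∃ F α₀≈β₀
    ⇔-∘ ((alphaTilde-tailVanishes⇔ F z α ×-⇔ betaTilde-tailVanishes⇔ F x y z h β)
         ⇔-∘ toeplitz-isDiagonal⇔ F _ _)
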